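{- Let $g_1,\dots,g_n$ be non-constant Boolean functions with $\mathrm{Rank}(g_i)=r_i$, and let $f:\{0,1\}^n\to\{0,1\}$ be non-constant. Then $$\mathrm{Rank}(f\circ(g_1,\dots,g_n))\le \mathrm{Depth}_w(f,[r_1,\dots,r_n]).$$
   Context: Decision trees query single variables at internal nodes and have $0/1$-labelled leaves. The rank of a rooted binary tree: leaves have rank $0$; an internal node with children of ranks $a,b$ has rank $a+1$ if $a=b$, else $\max\{a,b\}$; $\mathrm{Rank}(h)$ is the minimum rank of a decision tree computing $h$. For weights $w_1,\dots,w_n$ (cost $w_i$ for querying $x_i$), the weighted depth of a tree $T$ is the maximum over root-to-leaf paths of the sum of the weights of variables queried on the path; $\mathrm{Depth}_w(f,[w_1,\dots,w_n])$ is the minimum weighted depth of a decision tree computing $f$. For $g_i$ of arity $m_i$, $f\circ(g_1,\dots,g_n)(a^1,\dots,a^n)=f(g_1(a^1),\dots,g_n(a^n))$ with $a^i\in\{0,1\}^{m_i}$. -}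

module Defs where

open import Data.Bool using (Bool; true; false; if_then_else_)
open import Data.Nat using (ℕ; zero; suc; _+_; _⊔_; _≤_)
open import Data.Nat.Properties using (_≟_)
open import Data.Fin using (Fin)
open import Data.Product using (Σ; _×_; _,_; ∃)
open import Relation.Nullary using (¬_; yes; no)
open import Relation.Binary.PropositionalEquality using (_≡_)

BoolFun : Set → Set
BoolFun V = (V → Bool) → Bool

data DT (V : Set) : Set where
  leaf : Bool → DT V
  node : V → DT V → DT V → DT V

eval : {V : Set} → DT V → (V → Bool) → Bool
eval (leaf b) a = b
eval (node x t₀ t₁) a = if a x then eval t₁ a else eval t₀ a

Computes : {V : Set} → DT V → BoolFun V → Set
Computes t h = ∀ a → eval t a ≡ h a

rank : {V : Set} → DT V → ℕ
rank (leaf b) = 0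
rank (node x t₀ t₁) with rank t₀ | rank t₁
... | a | b with a ≟ b
...   | yes _ = suc a
...   | no _ = a ⊔ b

wdepth : {V : Set} → (V → ℕ) → DT V → ℕ
wdepth w (leaf b) = 0
wdepth w (node x t₀ t₁) = w x + (wdepth w t₀ ⊔ wdepth w t₁)

IsRank : {V : Set} → BoolFun V → ℕ → Set
IsRank h r = (Σ (DT _) λ t → Computes t h × rank t ≡ r)
           × (∀ t → Computes t h → r ≤ rank t)

IsWDepth : {V : Set} → BoolFun V → (V → ℕ) → ℕ → Set
IsWDepth f w d = (Σ (DT _) λ t → Computes t f × wdepth w t ≡ d)
               × (∀ t → Computes t f → d ≤ wdepth w t)

NonConstant : {V : Set} → BoolFun V → Set
NonConstant h = ∃ λ a → ∃ λ b → ¬ (h a ≡ h b)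

-- composition f ∘ (g₁,…,gₙ); the variables of the composed function are pairs (i , j), j-th bit of aⁱ
compose : {n : ℕ} {m : Fin n → ℕ} → BoolFun (Fin n) → ((i : Fin n) → BoolFun (Fin (m i)))
        → BoolFun (Σ (Fin n) λ i → Fin (m i))
compose f g a = f (λ i → g i (λ j → a (i , j)))

{-# OPTIONS --safe #-}
module Submission where

open import Defs
open import Data.Nat using (ℕ; _≤_; suc; _+_; _⊔_; z≤n; s≤s)
open import Data.Fin using (Fin)
open import Data.Nat.Properties
open import Data.Bool using (Bool; true; false; if_then_else_)
open import Data.Product using (Σ; _,_; proj₁; proj₂)
open import Data.Sum using (inj₁; inj₂)
open import Data.Empty using (⊥-elim)
open import Relation.Nullary using (yes; no)
open import Relation.Binary.PropositionalEquality

-- Take an optimal weighted-depth tree for f and replace each query of x_i by an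
-- optimal-rank tree for g_i whose 0-leaves continue into the 0-subtree and whose
-- 1-leaves continue into the 1-subtree. Grafting trees of rank ≤ k below the leaves
-- of a tree of rank r yields rank ≤ r + k, so by induction the rank of the composed
-- tree is at most the r-weighted depth of the outer tree.

rank-combine : ℕ → ℕ → ℕ
rank-combine a b with a ≟ b
... | yes _ = suc a
... | no _ = a ⊔ b

rank-node : {V : Set} (x : V) (t₀ t₁ : DT V) →
            rank (node x t₀ t₁) ≡ rank-combine (rank t₀) (rank t₁)
rank-node x t₀ t₁ with rank t₀ | rank t₁
... | a | b with a ≟ b
...   | yes _ = refl
...   | no _ = refl

⊔≤rank-combine : ∀ a b → a ⊔ b ≤ rank-combine a b
⊔≤rank-combine a b with a ≟ b
... | yes refl = ≤-trans (≤-reflexive (⊔-idem a)) (n≤1+n a)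
... | no _ = ≤-refl

rank-combine-mono-≤ : ∀ {a b a′ b′} → a ≤ a′ → b ≤ b′ → rank-combine a b ≤ rank-combine a′ b′
rank-combine-mono-≤ {a} {b} {a′} {b′} a≤a′ b≤b′ with a ≟ b
... | no _ = ≤-trans (⊔-mono-≤ a≤a′ b≤b′) (⊔≤rank-combine a′ b′)
... | yes refl with a′ ≟ b′
...   | yes _ = s≤s a≤a′
...   | no a′≢b′ with m≤n⇒m<n∨m≡n a≤a′ | m≤n⇒m<n∨m≡n b≤b′
...     | inj₁ a<a′ | _ = ≤-trans a<a′ (m≤m⊔n a′ b′)
...     | inj₂ _ | inj₁ a<b′ = ≤-trans a<b′ (m≤n⊔m a′ b′)
...     | inj₂ a≡a′ | inj₂ a≡b′ = ⊥-elim (a′≢b′ (trans (sym a≡a′) a≡b′))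

rank-combine-+ : ∀ a b k → rank-combine (a + k) (b + k) ≡ rank-combine a b + k
rank-combine-+ a b k with a ≟ b | a + k ≟ b + k
... | yes refl | yes _ = refl
... | yes refl | no a+k≢a+k = ⊥-elim (a+k≢a+k refl)
... | no a≢b | yes a+k≡b+k = ⊥-elim (a≢b (+-cancelʳ-≡ k a b a+k≡b+k))
... | no _ | no _ = sym (+-distribʳ-⊔ k a b)

module _ {W V : Set} (ι : W → V) where

  graft : DT W → DT V → DT V → DT V
  graft (leaf false) A B = A
  graft (leaf true) A B = B
  graft (node x t₀ t₁) A B = node (ι x) (graft t₀ A B) (graft t₁ A B)

  eval-graft : ∀ t A B (a : V → Bool) →
               eval (graft t A B) a ≡ (if eval t (λ x → a (ι x)) then eval B a else eval A a)
  eval-graft (leaf false) A B a = refl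
  eval-graft (leaf true) A B a = refl
  eval-graft (node x t₀ t₁) A B a with a (ι x)
  ... | true = eval-graft t₁ A B a
  ... | false = eval-graft t₀ A B a

  rank-graft-≤ : ∀ t A B k → rank A ≤ k → rank B ≤ k → rank (graft t A B) ≤ rank t + k
  rank-graft-≤ (leaf false) A B k rA≤k rB≤k = rA≤k
  rank-graft-≤ (leaf true) A B k rA≤k rB≤k = rB≤k
  rank-graft-≤ (node x t₀ t₁) A B k rA≤k rB≤k = begin
    rank (graft (node x t₀ t₁) A B)
      ≡⟨ rank-node (ι x) (graft t₀ A B) (graft t₁ A B) ⟩
    rank-combine (rank (graft t₀ A B)) (rank (graft t₁ A B))
      ≤⟨ rank-combine-mono-≤ (rank-graft-≤ t₀ A B k rA≤k rB≤k) (rank-graft-≤ t₁ A B k rA≤k rB≤k) ⟩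
    rank-combine (rank t₀ + k) (rank t₁ + k)
      ≡⟨ rank-combine-+ (rank t₀) (rank t₁) k ⟩
    rank-combine (rank t₀) (rank t₁) + k
      ≡⟨ cong (_+ k) (rank-node x t₀ t₁) ⟨
    rank (node x t₀ t₁) + k
      ∎
    where open ≤-Reasoning

module _ {I : Set} {W : I → Set} (inner : (i : I) → DT (W i)) where

  substitute : DT I → DT (Σ I W)
  substitute (leaf b) = leaf b
  substitute (node i T₀ T₁) = graft (i ,_) (inner i) (substitute T₀) (substitute T₁)

  eval-substitute : (g : (i : I) → BoolFun (W i)) → (∀ i → Computes (inner i) (g i)) →
                    ∀ T (a : Σ I W → Bool) →
                    eval (substitute T) a ≡ eval T (λ i → g i (λ x → a (i , x)))
  eval-substitute g inner-g (leaf b) a = refl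
  eval-substitute g inner-g (node i T₀ T₁) a
    rewrite eval-graft (i ,_) (inner i) (substitute T₀) (substitute T₁) a
          | inner-g i (λ x → a (i , x))
    with g i (λ x → a (i , x))
  ... | true = eval-substitute g inner-g T₁ a
  ... | false = eval-substitute g inner-g T₀ a

  rank-substitute-≤ : (r : I → ℕ) → (∀ i → rank (inner i) ≡ r i) →
                      ∀ T → rank (substitute T) ≤ wdepth r T
  rank-substitute-≤ r rank-inner (leaf b) = z≤n
  rank-substitute-≤ r rank-inner (node i T₀ T₁) =
    subst (λ ri → rank (substitute (node i T₀ T₁)) ≤ ri + k) (rank-inner i)
      (rank-graft-≤ (i ,_) (inner i) (substitute T₀) (substitute T₁) k
        (≤-trans (rank-substitute-≤ r rank-inner T₀) (m≤m⊔n _ _))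
        (≤-trans (rank-substitute-≤ r rank-inner T₁) (m≤n⊔m _ _)))
    where k = wdepth r T₀ ⊔ wdepth r T₁

theorem6p3 : (n : ℕ) (m : Fin n → ℕ) (f : BoolFun (Fin n))
             (g : (i : Fin n) → BoolFun (Fin (m i))) (r : Fin n → ℕ) →
             (∀ i → NonConstant (g i)) → (∀ i → IsRank (g i) (r i)) → NonConstant f →
             (R d : ℕ) → IsRank (compose {n} {m} f g) R → IsWDepth f r d → R ≤ d
theorem6p3 n m f g r _ rank-g _ R d (_ , R-minimal) ((T , T-f , wdepth-T) , _) = begin
  R                         ≤⟨ R-minimal (substitute inner T) substitute-computes ⟩
  rank (substitute inner T) ≤⟨ rank-substitute-≤ inner r rank-inner T ⟩
  wdepth r T                ≡⟨ wdepth-T ⟩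
  d                         ∎
  where
  open ≤-Reasoning
  inner : (i : Fin n) → DT (Fin (m i))
  inner i = proj₁ (proj₁ (rank-g i))
  rank-inner : ∀ i → rank (inner i) ≡ r i
  rank-inner i = proj₂ (proj₂ (proj₁ (rank-g i)))
  substitute-computes : Computes (substitute inner T) (compose {n} {m} f g)
  substitute-computes a =
    trans (eval-substitute inner g (λ i → proj₁ (proj₂ (proj₁ (rank-g i)))) T a) (T-f _)
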